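{- For positive integers $r,n$, define $$A_{n,r}(x,y,s,t,p,q)=\sum_{\pi^c\in\mathbb{Z}_r\wr\mathcal{S}_n}x^{\mathrm{exc}_B(\pi^c)}y^{\mathrm{aexc}(\pi^c)}s^{\mathrm{single}(\pi^c)}t^{\mathrm{fix}(\pi^c)}p^{\mathrm{csum}(\pi^c)}q^{\mathrm{cyc}(\pi^c)}.$$ Then $$A_{n,r}(x,y,s,t,p,q)=[r]_p^ny^nA_n\left(\frac{x}{y},\frac{t+sp[r-1]_p}{[r]_py},q\right).$$ In particular, $$\sum_{\pi^c\in\mathbb{Z}_r\wr\mathcal{S}_n}x^{\mathrm{exc}(\pi^c)}t^{\mathrm{fix}(\pi^c)}p^{\mathrm{csum}(\pi^c)}q^{\mathrm{cyc}(\pi^c)}=A_{n,r}(x,1,x,t,p,q)=[r]_p^nA_n\left(x,\frac{t+xp[r-1]_p}{[r]_p},q\right).$$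
   Context: $[m]_p=1+p+\cdots+p^{m-1}$ for $m\geqslant1$, $[0]_p=0$. $A_n(x,p,q)=\sum_{\pi\in\mathcal{S}_n}x^{\mathrm{exc}(\pi)}p^{\mathrm{fix}(\pi)}q^{\mathrm{cyc}(\pi)}$ with $\mathrm{exc}(\pi)=\#\{i:\pi(i)>i\}$, $\mathrm{fix}(\pi)=\#\{i:\pi(i)=i\}$, $\mathrm{cyc}$ the number of cycles. $\mathbb{Z}_r\wr\mathcal{S}_n$ is the set of $r$-colored permutations $\pi^c=\pi_1^{c_1}\cdots\pi_n^{c_n}$, $\pi\in\mathcal{S}_n$, $c_i\in\{0,\dots,r-1\}$. Statistics: $\mathrm{exc}_B(\pi^c)=\#\{i:\pi_i>i\}$; $\mathrm{aexc}(\pi^c)=\#\{i:\pi_i<i\}$; $\mathrm{single}(\pi^c)=\#\{i:\pi_i=i,\ c_i>0\}$; $\mathrm{fix}(\pi^c)=\#\{i:\pi_i=i,\ c_i=0\}$; $\mathrm{exc}(\pi^c)=\mathrm{exc}_B(\pi^c)+\mathrm{single}(\pi^c)$; $\mathrm{csum}(\pi^c)=\sum_i c_i$; $\mathrm{cyc}(\pi^c)$ is the number of cycles of $\pi$. -}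

module Defs where

open import Data.Bool using (Bool; true; false; _∧_; not; if_then_else_)
open import Data.Nat as ℕ using (ℕ; zero; suc; _≡ᵇ_; _<ᵇ_; _≤ᵇ_)
open import Data.Fin using (Fin; zero; suc; toℕ)
open import Data.List using (List; []; _∷_; [_]; map; concatMap; filterᵇ; length; foldr; allFin)
open import Data.Bool.ListAction using (and)
open import Data.Rational using (ℚ; 0ℚ; 1ℚ; _+_; _*_; _/_)
open import Data.Integer using (+_)

_^_ : ℚ → ℕ → ℚ
a ^ zero  = 1ℚ
a ^ suc k = a * (a ^ k)

qint : ℕ → ℚ → ℚ
qint zero p = 0ℚ
qint (suc m) p = 1ℚ + p * (qint m p)

ofℕ : ℕ → ℚ
ofℕ k = (+ k) / 1

extend : ∀ {n m} → Fin m → (Fin n → Fin m) → Fin (suc n) → Fin m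
extend a f zero    = a
extend a f (suc i) = f i

allFuns : (n m : ℕ) → List (Fin n → Fin m)
allFuns zero    m = [ (λ ()) ]
allFuns (suc n) m = concatMap (λ f → map (λ a → extend a f) (allFin m)) (allFuns n m)

_==F_ : ∀ {n} → Fin n → Fin n → Bool
i ==F j = toℕ i ≡ᵇ toℕ j

isInjective : ∀ {n} → (Fin n → Fin n) → Bool
isInjective {n} f =
  and (map (λ i → and (map (λ j → if f i ==F f j then i ==F j else true) (allFin n))) (allFin n))

Perms : (n : ℕ) → List (Fin n → Fin n)
Perms n = filterᵇ isInjective (allFuns n n)

count : ∀ {n} → (Fin n → Bool) → ℕ
count {n} P = length (filterᵇ P (allFin n))

sumℚ : ∀ {A : Set} → (A → ℚ) → List A → ℚ
sumℚ f = foldr (λ a acc → f a + acc) 0ℚ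

iter : ∀ {n} → (Fin n → Fin n) → ℕ → Fin n → Fin n
iter f zero    i = i
iter f (suc k) i = f (iter f k i)

excP : ∀ {n} → (Fin n → Fin n) → ℕ
excP π = count (λ i → toℕ i <ᵇ toℕ (π i))

aexcP : ∀ {n} → (Fin n → Fin n) → ℕ
aexcP π = count (λ i → toℕ (π i) <ᵇ toℕ i)

fixP : ∀ {n} → (Fin n → Fin n) → ℕ
fixP π = count (λ i → π i ==F i)

isCycleMin : ∀ {n} → (Fin n → Fin n) → Fin n → Bool
isCycleMin {n} π i = and (map (λ k → toℕ i ≤ᵇ toℕ (iter π (suc k) i)) (Data.List.upTo n))
  where import Data.List

-- number of cycles = number of cycle minima
cycP : ∀ {n} → (Fin n → Fin n) → ℕ
cycP π = count (isCycleMin π)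

A : ℕ → ℚ → ℚ → ℚ → ℚ
A n x p q = sumℚ (λ π → (x ^ excP π) * ((p ^ fixP π) * (q ^ cycP π))) (Perms n)

-- Colored permutations Z_r ≀ S_n : pairs (π , c), c : Fin n → Fin r

record Colored (n r : ℕ) : Set where
  constructor _,,_
  field
    perm  : Fin n → Fin n
    color : Fin n → Fin r
open Colored public

ColoredPerms : (n r : ℕ) → List (Colored n r)
ColoredPerms n r = concatMap (λ π → map (λ c → π ,, c) (allFuns n r)) (Perms n)

isZero : ∀ {r} → Fin r → Bool
isZero zero    = true
isZero (suc _) = false

excB : ∀ {n r} → Colored n r → ℕ
excB σ = excP (perm σ)

aexc : ∀ {n r} → Colored n r → ℕ
aexc σ = aexcP (perm σ)

single : ∀ {n r} → Colored n r → ℕ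
single σ = count (λ i → (perm σ i ==F i) ∧ not (isZero (color σ i)))

fixC : ∀ {n r} → Colored n r → ℕ
fixC σ = count (λ i → (perm σ i ==F i) ∧ isZero (color σ i))

excC : ∀ {n r} → Colored n r → ℕ
excC σ = excB σ ℕ.+ single σ

csum : ∀ {n r} → Colored n r → ℕ
csum {n} σ = foldr (λ i acc → toℕ (color σ i) ℕ.+ acc) 0 (allFin n)

cyc : ∀ {n r} → Colored n r → ℕ
cyc σ = cycP (perm σ)

Anr : (n r : ℕ) → ℚ → ℚ → ℚ → ℚ → ℚ → ℚ → ℚ
Anr n r x y s t p q =
  sumℚ (λ σ → (x ^ excB σ) * ((y ^ aexc σ) * ((s ^ single σ) * ((t ^ fixC σ) * ((p ^ csum σ) * (q ^ cyc σ))))))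
       (ColoredPerms n r)

Bnr : (n r : ℕ) → ℚ → ℚ → ℚ → ℚ → ℚ
Bnr n r x t p q =
  sumℚ (λ σ → (x ^ excC σ) * ((t ^ fixC σ) * ((p ^ csum σ) * (q ^ cyc σ)))) (ColoredPerms n r)

-- Fix the underlying permutation π. Every statistic except csum, single and fix depends on π
-- alone, and those three are sums of contributions of the single positions, so the sum over
-- the r^n colourings of π factorises over the positions i: an excedance contributes x [r]_p,
-- an anti-excedance y [r]_p, and a fixed point t + s (p + ⋯ + p^(r-1)) = t + s p [r-1]_p
-- (colour 0 gives t, colour a > 0 gives s p^a). This is exactly the position-wise product of
-- [r]_p y (x/y)^exc ((t + s p [r-1]_p)/([r]_p y))^fix.
module Submission where

open import Defs
open import Data.Nat using (ℕ; suc; pred; _≤_)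
open import Data.Rational using (ℚ; 1ℚ; _+_; _*_; _÷_; NonZero)
open import Relation.Binary.PropositionalEquality using (_≡_)
open import Data.Product using (_×_)

open import Algebra.Bundles using (CommutativeRing)
open import Data.Bool using (Bool; true; false; if_then_else_; _∧_; not)
open import Data.Fin using (Fin; zero; suc; toℕ)
open import Data.List using (List; []; _∷_; map; concatMap; filterᵇ; length; foldr; allFin; tabulate; _++_)
open import Data.Maybe using (nothing)
import Data.Nat as ℕ
open import Data.Nat using (zero)
open import Data.Product using (_,_)
open import Data.Rational using (1/_)
import Data.Rational.Properties as ℚ
open import Function using (_∘_; id)
open import Level using (0ℓ)
open import Relation.Binary.PropositionalEquality
  using (_≗_; refl; sym; trans; cong; cong₂; module ≡-Reasoning)
open import Tactic.RingSolver using (solve-∀)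
open import Tactic.RingSolver.Core.AlmostCommutativeRing using (AlmostCommutativeRing; fromCommutativeRing)

open import Algebra.Properties.Semiring.Sum (CommutativeRing.semiring ℚ.+-*-commutativeRing)
  using (sum-syntax; sum-cong-≗; *-distribˡ-sum) renaming (sum to ∑)
open import Algebra.Properties.CommutativeMonoid.Sum ℚ.*-1-commutativeMonoid
  using () renaming (sum to ∏; sum-cong-≗ to ∏-cong; ∑-distrib-+ to ∏-distrib-*)

open ≡-Reasoning

ℚ-ring : AlmostCommutativeRing 0ℓ 0ℓ
ℚ-ring = fromCommutativeRing ℚ.+-*-commutativeRing (λ _ → nothing)

∏-distrib-*³ : ∀ {n} (f g h k : Fin n → ℚ) →
  ∏ (λ i → f i * (g i * (h i * k i))) ≡ ∏ f * (∏ g * (∏ h * ∏ k))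
∏-distrib-*³ f g h k =
  trans (∏-distrib-* f _) (cong (∏ f *_)
    (trans (∏-distrib-* g _) (cong (∏ g *_) (∏-distrib-* h k))))

private
  variable
    X Y : Set

sumℚ-++ : ∀ (f : X → ℚ) xs ys → sumℚ f (xs ++ ys) ≡ sumℚ f xs + sumℚ f ys
sumℚ-++ f []       ys = sym (ℚ.+-identityˡ _)
sumℚ-++ f (x ∷ xs) ys = trans (cong (f x +_) (sumℚ-++ f xs ys)) (sym (ℚ.+-assoc (f x) _ _))

sumℚ-map : ∀ (f : Y → ℚ) (h : X → Y) xs → sumℚ f (map h xs) ≡ sumℚ (f ∘ h) xs
sumℚ-map f h []       = refl
sumℚ-map f h (x ∷ xs) = cong (f (h x) +_) (sumℚ-map f h xs)

sumℚ-concatMap : ∀ (f : Y → ℚ) (g : X → List Y) xs →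
  sumℚ f (concatMap g xs) ≡ sumℚ (λ a → sumℚ f (g a)) xs
sumℚ-concatMap f g []       = refl
sumℚ-concatMap f g (x ∷ xs) =
  trans (sumℚ-++ f (g x) (concatMap g xs)) (cong (sumℚ f (g x) +_) (sumℚ-concatMap f g xs))

sumℚ-cong : ∀ {f g : X → ℚ} → f ≗ g → ∀ xs → sumℚ f xs ≡ sumℚ g xs
sumℚ-cong f≗g []       = refl
sumℚ-cong f≗g (x ∷ xs) = cong₂ _+_ (f≗g x) (sumℚ-cong f≗g xs)

*-distribˡ-sumℚ : ∀ k (f : X → ℚ) xs → k * sumℚ f xs ≡ sumℚ (λ a → k * f a) xs
*-distribˡ-sumℚ k f []       = ℚ.*-zeroʳ k
*-distribˡ-sumℚ k f (x ∷ xs) =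
  trans (ℚ.*-distribˡ-+ k (f x) (sumℚ f xs)) (cong (k * f x +_) (*-distribˡ-sumℚ k f xs))

*-distribʳ-sumℚ : ∀ k (f : X → ℚ) xs → sumℚ f xs * k ≡ sumℚ (λ a → f a * k) xs
*-distribʳ-sumℚ k f []       = ℚ.*-zeroˡ k
*-distribʳ-sumℚ k f (x ∷ xs) =
  trans (ℚ.*-distribʳ-+ k (f x) (sumℚ f xs)) (cong (f x * k +_) (*-distribʳ-sumℚ k f xs))

sumℚ-tabulate : ∀ {n} (f : X → ℚ) (h : Fin n → X) → sumℚ f (tabulate h) ≡ ∑ (f ∘ h)
sumℚ-tabulate {n = zero}  f h = refl
sumℚ-tabulate {n = suc n} f h = cong (f (h zero) +_) (sumℚ-tabulate f (h ∘ suc))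

_^ᵇ_ : ℚ → Bool → ℚ
z ^ᵇ true  = z
z ^ᵇ false = 1ℚ

^-+ : ∀ z m n → z ^ (m ℕ.+ n) ≡ z ^ m * z ^ n
^-+ z zero    n = sym (ℚ.*-identityˡ _)
^-+ z (suc m) n = trans (cong (z *_) (^-+ z m n)) (sym (ℚ.*-assoc z _ _))

^-zeroˡ : ∀ n → 1ℚ ^ n ≡ 1ℚ
^-zeroˡ zero    = refl
^-zeroˡ (suc n) = trans (ℚ.*-identityˡ _) (^-zeroˡ n)

^≡∏ : ∀ z n → z ^ n ≡ ∏ {n} (λ _ → z)
^≡∏ z zero    = refl
^≡∏ z (suc n) = cong (z *_) (^≡∏ z n)

^-length-filter : ∀ {n} z (P : X → Bool) (h : Fin n → X) →
  z ^ length (filterᵇ P (tabulate h)) ≡ ∏ (λ i → z ^ᵇ P (h i))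
^-length-filter {n = zero}  z P h = refl
^-length-filter {n = suc n} z P h with P (h zero)
... | true  = cong (z *_) (^-length-filter z P (h ∘ suc))
... | false = trans (^-length-filter z P (h ∘ suc)) (sym (ℚ.*-identityˡ _))

^-sum-tabulate : ∀ {n} z (g : X → ℕ) (h : Fin n → X) →
  z ^ foldr (λ a acc → g a ℕ.+ acc) 0 (tabulate h) ≡ ∏ (λ i → z ^ g (h i))
^-sum-tabulate {n = zero}  z g h = refl
^-sum-tabulate {n = suc n} z g h =
  trans (^-+ z (g (h zero)) _) (cong (z ^ g (h zero) *_) (^-sum-tabulate z g (h ∘ suc)))

^-count : ∀ {n} z (P : Fin n → Bool) → z ^ count P ≡ ∏ (λ i → z ^ᵇ P i)
^-count z P = ^-length-filter z P id

∑-allFuns-∏ : ∀ n r (w : Fin n → Fin r → ℚ) →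
  sumℚ (λ c → ∏ (λ i → w i (c i))) (allFuns n r) ≡ ∏ (λ i → ∑ (w i))
∑-allFuns-∏ zero    r w = ℚ.+-identityʳ 1ℚ
∑-allFuns-∏ (suc n) r w = begin
    sumℚ F (allFuns (suc n) r)
  ≡⟨ sumℚ-concatMap F (λ f → map (λ a → extend a f) (allFin r)) (allFuns n r) ⟩
    sumℚ (λ f → sumℚ F (map (λ a → extend a f) (allFin r))) (allFuns n r)
  ≡⟨ sumℚ-cong (λ f → sumℚ-map F (λ a → extend a f) (allFin r)) (allFuns n r) ⟩
    sumℚ (λ f → sumℚ (λ a → w zero a * rest f) (allFin r)) (allFuns n r)
  ≡⟨ sumℚ-cong (λ f → sym (*-distribʳ-sumℚ (rest f) (w zero) (allFin r))) (allFuns n r) ⟩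
    sumℚ (λ f → sumℚ (w zero) (allFin r) * rest f) (allFuns n r)
  ≡⟨ sym (*-distribˡ-sumℚ (sumℚ (w zero) (allFin r)) rest (allFuns n r)) ⟩
    sumℚ (w zero) (allFin r) * sumℚ rest (allFuns n r)
  ≡⟨ cong₂ _*_ (sumℚ-tabulate (w zero) id) (∑-allFuns-∏ n r (w ∘ suc)) ⟩
    ∑ (w zero) * ∏ (λ i → ∑ (w (suc i)))
  ∎
  where
    F : (Fin (suc n) → Fin r) → ℚ
    F c = ∏ (λ i → w i (c i))

    rest : (Fin n → Fin r) → ℚ
    rest f = ∏ (λ i → w (suc i) (f i))

∑-geometric : ∀ m p → (∑[ a < m ] (p ^ toℕ a)) ≡ qint m p
∑-geometric zero    p = refl
∑-geometric (suc m) p =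
  cong (1ℚ +_) (trans (sym (*-distribˡ-sum {m} p (λ a → p ^ toℕ a))) (cong (p *_) (∑-geometric m p)))

colourWeight : ∀ {r} (s t p : ℚ) → Bool → Fin r → ℚ
colourWeight s t p fixed a = s ^ᵇ (fixed ∧ not (isZero a)) * (t ^ᵇ (fixed ∧ isZero a) * p ^ toℕ a)

∑-colourWeight : ∀ r s t p fixed →
  ∑ (colourWeight {suc r} s t p fixed) ≡ (if fixed then t + s * (p * qint r p) else qint (suc r) p)
∑-colourWeight r s t p true = begin
    1ℚ * (t * 1ℚ) + (∑[ a < r ] (s * (1ℚ * (p * p ^ toℕ a))))
  ≡⟨ cong (1ℚ * (t * 1ℚ) +_) (sum-cong-≗ {r} (λ a → cong (s *_) (ℚ.*-identityˡ _))) ⟩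
    1ℚ * (t * 1ℚ) + (∑[ a < r ] (s * (p * p ^ toℕ a)))
  ≡⟨ cong (1ℚ * (t * 1ℚ) +_) (sym (*-distribˡ-sum {r} s (λ a → p * p ^ toℕ a))) ⟩
    1ℚ * (t * 1ℚ) + s * (∑[ a < r ] (p * p ^ toℕ a))
  ≡⟨ cong (λ z → 1ℚ * (t * 1ℚ) + s * z)
       (trans (sym (*-distribˡ-sum {r} p (λ a → p ^ toℕ a))) (cong (p *_) (∑-geometric r p))) ⟩
    1ℚ * (t * 1ℚ) + s * (p * qint r p)
  ≡⟨ cong (_+ s * (p * qint r p)) (trans (ℚ.*-identityˡ _) (ℚ.*-identityʳ t)) ⟩
    t + s * (p * qint r p)
  ∎
∑-colourWeight r s t p false =
  trans (sum-cong-≗ {suc r} {colourWeight s t p false} {λ a → p ^ toℕ a}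
           (λ a → trans (ℚ.*-identityˡ _) (ℚ.*-identityˡ _)))
    (∑-geometric (suc r) p)

isExc isAexc isFix : ∀ {n} → (Fin n → Fin n) → Fin n → Bool
isExc  π i = toℕ i ℕ.<ᵇ toℕ (π i)
isAexc π i = toℕ (π i) ℕ.<ᵇ toℕ i
isFix  π i = π i ==F i

data Comparison : Bool → Bool → Bool → Set where
  less    : Comparison true  false false
  greater : Comparison false true  false
  equal   : Comparison false false true

compareᵇ : ∀ m n → Comparison (m ℕ.<ᵇ n) (n ℕ.<ᵇ m) (n ℕ.≡ᵇ m)
compareᵇ zero    zero    = equal
compareᵇ zero    (suc n) = less
compareᵇ (suc m) zero    = greater
compareᵇ (suc m) (suc n) = compareᵇ m n

compare-position : ∀ {n} (π : Fin n → Fin n) i → Comparison (isExc π i) (isAexc π i) (isFix π i)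
compare-position π i = compareᵇ (toℕ i) (toℕ (π i))

colouredWeight : ∀ {n r} (x y s t p q : ℚ) → Colored n r → ℚ
colouredWeight x y s t p q σ =
  x ^ excB σ * (y ^ aexc σ * (s ^ single σ * (t ^ fixC σ * (p ^ csum σ * q ^ cyc σ))))

positionWeight : ∀ {n r} (x y s t p : ℚ) (π : Fin n → Fin n) → Fin n → Fin r → ℚ
positionWeight x y s t p π i a = x ^ᵇ isExc π i * (y ^ᵇ isAexc π i * colourWeight s t p (isFix π i) a)

colouredWeight-factorises : ∀ {n r} x y s t p q (π : Fin n → Fin n) (c : Fin n → Fin r) →
  colouredWeight x y s t p q (π ,, c) ≡ ∏ (λ i → positionWeight x y s t p π i (c i)) * q ^ cycP π
colouredWeight-factorises {n} x y s t p q π c = begin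
    x ^ excP π * (y ^ aexcP π * (s ^ single (π ,, c) * (t ^ fixC (π ,, c) * (p ^ csum (π ,, c) * Q))))
  ≡⟨ cong₂ _*_ (^-count x (isExc π)) (cong₂ _*_ (^-count y (isAexc π))
       (cong₂ _*_ (^-count s (λ i → isFix π i ∧ not (isZero (c i))))
       (cong₂ _*_ (^-count t (λ i → isFix π i ∧ isZero (c i))) (cong (_* Q) (^-sum-tabulate p (toℕ ∘ c) id))))) ⟩
    ∏ xᵢ * (∏ yᵢ * (∏ sᵢ * (∏ tᵢ * (∏ pᵢ * Q))))
  ≡⟨ reassociate (∏ xᵢ) (∏ yᵢ) (∏ sᵢ) (∏ tᵢ) (∏ pᵢ) Q ⟩
    (∏ xᵢ * (∏ yᵢ * (∏ sᵢ * (∏ tᵢ * ∏ pᵢ)))) * Q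
  ≡⟨ cong (_* Q) (sym (trans (∏-distrib-*³ xᵢ yᵢ sᵢ (λ i → tᵢ i * pᵢ i))
       (cong (λ z → ∏ xᵢ * (∏ yᵢ * (∏ sᵢ * z))) (∏-distrib-* tᵢ pᵢ)))) ⟩
    ∏ (λ i → positionWeight x y s t p π i (c i)) * Q
  ∎
  where
    Q : ℚ
    Q = q ^ cycP π
    xᵢ yᵢ sᵢ tᵢ pᵢ : Fin n → ℚ
    xᵢ i = x ^ᵇ isExc π i
    yᵢ i = y ^ᵇ isAexc π i
    sᵢ i = s ^ᵇ (isFix π i ∧ not (isZero (c i)))
    tᵢ i = t ^ᵇ (isFix π i ∧ isZero (c i))
    pᵢ i = p ^ toℕ (c i)
    reassociate : ∀ (a b c d e q : ℚ) → a * (b * (c * (d * (e * q)))) ≡ (a * (b * (c * (d * e)))) * q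
    reassociate = solve-∀ ℚ-ring

positionSum : ∀ {n} (π : Fin n → Fin n) (x y T R : ℚ) → Fin n → ℚ
positionSum π x y T R i = x ^ᵇ isExc π i * (y ^ᵇ isAexc π i * (if isFix π i then T else R))

∑-colourings : ∀ {n} r x y s t p q (π : Fin n → Fin n) →
  sumℚ (λ c → colouredWeight x y s t p q (π ,, c)) (allFuns n (suc r))
  ≡ ∏ (positionSum π x y (t + s * (p * qint r p)) (qint (suc r) p)) * q ^ cycP π
∑-colourings {n} r x y s t p q π = begin
    sumℚ (λ c → colouredWeight x y s t p q (π ,, c)) (allFuns n (suc r))
  ≡⟨ sumℚ-cong (colouredWeight-factorises x y s t p q π) (allFuns n (suc r)) ⟩
    sumℚ (λ c → ∏ (λ i → w i (c i)) * Q) (allFuns n (suc r))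
  ≡⟨ sym (*-distribʳ-sumℚ Q (λ c → ∏ (λ i → w i (c i))) (allFuns n (suc r))) ⟩
    sumℚ (λ c → ∏ (λ i → w i (c i))) (allFuns n (suc r)) * Q
  ≡⟨ cong (_* Q) (trans (∑-allFuns-∏ n (suc r) w) (∏-cong ∑-positionWeight)) ⟩
    ∏ (positionSum π x y (t + s * (p * qint r p)) (qint (suc r) p)) * Q
  ∎
  where
    Q : ℚ
    Q = q ^ cycP π

    w : Fin n → Fin (suc r) → ℚ
    w = positionWeight x y s t p π

    ∑-positionWeight : ∀ i → ∑ (w i) ≡ positionSum π x y (t + s * (p * qint r p)) (qint (suc r) p) i
    ∑-positionWeight i = begin
        ∑ (w i)
      ≡⟨ sym (*-distribˡ-sum {suc r} (x ^ᵇ isExc π i) (λ a → y ^ᵇ isAexc π i * colourWeight s t p (isFix π i) a)) ⟩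
        x ^ᵇ isExc π i * ∑ {suc r} (λ a → y ^ᵇ isAexc π i * colourWeight s t p (isFix π i) a)
      ≡⟨ cong (x ^ᵇ isExc π i *_) (sym (*-distribˡ-sum {suc r} (y ^ᵇ isAexc π i) (colourWeight s t p (isFix π i)))) ⟩
        x ^ᵇ isExc π i * (y ^ᵇ isAexc π i * ∑ (colourWeight {suc r} s t p (isFix π i)))
      ≡⟨ cong (λ z → x ^ᵇ isExc π i * (y ^ᵇ isAexc π i * z)) (∑-colourWeight r s t p (isFix π i)) ⟩
        positionSum π x y (t + s * (p * qint r p)) (qint (suc r) p) i
      ∎

position-identity : ∀ (x y T R : ℚ) .{{_ : NonZero y}} .{{_ : NonZero R}} {e a f} → Comparison e a f →
  R * (y * ((x ÷ y) ^ᵇ e * ((T ÷ R) ÷ y) ^ᵇ f)) ≡ x ^ᵇ e * (y ^ᵇ a * (if f then T else R))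
position-identity x y T R less = begin
    R * (y * ((x * 1/ y) * 1ℚ))  ≡⟨ rearrange R y x (1/ y) ⟩
    (x * (1ℚ * R)) * (y * 1/ y)  ≡⟨ cong ((x * (1ℚ * R)) *_) (ℚ.*-inverseʳ y) ⟩
    (x * (1ℚ * R)) * 1ℚ          ≡⟨ ℚ.*-identityʳ _ ⟩
    x * (1ℚ * R)                 ∎
  where
    rearrange : ∀ R y x u → R * (y * ((x * u) * 1ℚ)) ≡ (x * (1ℚ * R)) * (y * u)
    rearrange = solve-∀ ℚ-ring
position-identity x y T R greater = rearrange R y
  where
    rearrange : ∀ R y → R * (y * (1ℚ * 1ℚ)) ≡ 1ℚ * (y * R)
    rearrange = solve-∀ ℚ-ring
position-identity x y T R equal = begin
    R * (y * (1ℚ * ((T * 1/ R) * 1/ y)))         ≡⟨ rearrange R y T (1/ R) (1/ y) ⟩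
    (1ℚ * (1ℚ * T)) * ((R * 1/ R) * (y * 1/ y))  ≡⟨ cong₂ (λ u v → (1ℚ * (1ℚ * T)) * (u * v))
                                                         (ℚ.*-inverseʳ R) (ℚ.*-inverseʳ y) ⟩
    (1ℚ * (1ℚ * T)) * (1ℚ * 1ℚ)                  ≡⟨ ℚ.*-identityʳ _ ⟩
    1ℚ * (1ℚ * T)                                ∎
  where
    rearrange : ∀ R y T u v → R * (y * (1ℚ * ((T * u) * v))) ≡ (1ℚ * (1ℚ * T)) * ((R * u) * (y * v))
    rearrange = solve-∀ ℚ-ring

scaled-term : ∀ {n} (π : Fin n → Fin n) (x y T R q : ℚ) .{{_ : NonZero y}} .{{_ : NonZero R}} →
  R ^ n * (y ^ n * ((x ÷ y) ^ excP π * (((T ÷ R) ÷ y) ^ fixP π * q ^ cycP π)))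
  ≡ ∏ (positionSum π x y T R) * q ^ cycP π
scaled-term {n} π x y T R q = begin
    R ^ n * (y ^ n * ((x ÷ y) ^ excP π * (((T ÷ R) ÷ y) ^ fixP π * Q)))
  ≡⟨ cong₂ _*_ (^≡∏ R n) (cong₂ _*_ (^≡∏ y n)
       (cong₂ _*_ (^-count (x ÷ y) (isExc π)) (cong (_* Q) (^-count ((T ÷ R) ÷ y) (isFix π))))) ⟩
    ∏ Rᵢ * (∏ yᵢ * (∏ eᵢ * (∏ fᵢ * Q)))
  ≡⟨ reassociate (∏ Rᵢ) (∏ yᵢ) (∏ eᵢ) (∏ fᵢ) Q ⟩
    (∏ Rᵢ * (∏ yᵢ * (∏ eᵢ * ∏ fᵢ))) * Q
  ≡⟨ cong (_* Q) (sym (∏-distrib-*³ Rᵢ yᵢ eᵢ fᵢ)) ⟩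
    ∏ (λ i → R * (y * (eᵢ i * fᵢ i))) * Q
  ≡⟨ cong (_* Q) (∏-cong (λ i → position-identity x y T R (compare-position π i))) ⟩
    ∏ (positionSum π x y T R) * Q
  ∎
  where
    Q : ℚ
    Q = q ^ cycP π
    Rᵢ yᵢ eᵢ fᵢ : Fin n → ℚ
    Rᵢ _ = R
    yᵢ _ = y
    eᵢ i = (x ÷ y) ^ᵇ isExc π i
    fᵢ i = ((T ÷ R) ÷ y) ^ᵇ isFix π i
    reassociate : ∀ (a b c d q : ℚ) → a * (b * (c * (d * q))) ≡ (a * (b * (c * d))) * q
    reassociate = solve-∀ ℚ-ring

Anr≡A : ∀ n r (x y s t p q : ℚ) .{{_ : NonZero y}} .{{_ : NonZero (qint (suc r) p)}} →
  Anr n (suc r) x y s t p q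
  ≡ qint (suc r) p ^ n * (y ^ n * A n (x ÷ y) (((t + s * (p * qint r p)) ÷ qint (suc r) p) ÷ y) q)
Anr≡A n r x y s t p q = begin
    sumℚ weight (concatMap (λ π → map (λ c → π ,, c) (allFuns n (suc r))) (Perms n))
  ≡⟨ sumℚ-concatMap weight (λ π → map (λ c → π ,, c) (allFuns n (suc r))) (Perms n) ⟩
    sumℚ (λ π → sumℚ weight (map (λ c → π ,, c) (allFuns n (suc r)))) (Perms n)
  ≡⟨ sumℚ-cong (λ π → trans (sumℚ-map weight (λ c → π ,, c) (allFuns n (suc r))) (∑-colourings r x y s t p q π))
       (Perms n) ⟩
    sumℚ (λ π → ∏ (positionSum π x y T R) * q ^ cycP π) (Perms n)
  ≡⟨ sumℚ-cong (λ π → sym (scaled-term π x y T R q)) (Perms n) ⟩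
    sumℚ (λ π → R ^ n * (y ^ n * term π)) (Perms n)
  ≡⟨ sym (*-distribˡ-sumℚ (R ^ n) (λ π → y ^ n * term π) (Perms n)) ⟩
    R ^ n * sumℚ (λ π → y ^ n * term π) (Perms n)
  ≡⟨ cong (R ^ n *_) (sym (*-distribˡ-sumℚ (y ^ n) term (Perms n))) ⟩
    R ^ n * (y ^ n * sumℚ term (Perms n))
  ∎
  where
    T R : ℚ
    T = t + s * (p * qint r p)
    R = qint (suc r) p
    weight : Colored n (suc r) → ℚ
    weight = colouredWeight x y s t p q
    term : (Fin n → Fin n) → ℚ
    term π = (x ÷ y) ^ excP π * ((((T ÷ R) ÷ y) ^ fixP π) * q ^ cycP π)

Bnr≡Anr : ∀ n r x t p q → Bnr n r x t p q ≡ Anr n r x 1ℚ x t p q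
Bnr≡Anr n r x t p q = sumℚ-cong split-exc (ColoredPerms n r)
  where
    split-exc : ∀ σ → x ^ excC σ * (t ^ fixC σ * (p ^ csum σ * q ^ cyc σ))
                    ≡ colouredWeight x 1ℚ x t p q σ
    split-exc σ = begin
        x ^ (excB σ ℕ.+ single σ) * rest
      ≡⟨ cong (_* rest) (^-+ x (excB σ) (single σ)) ⟩
        (x ^ excB σ * x ^ single σ) * rest
      ≡⟨ rearrange (x ^ excB σ) (x ^ single σ) rest ⟩
        x ^ excB σ * (1ℚ * (x ^ single σ * rest))
      ≡⟨ cong (λ z → x ^ excB σ * (z * (x ^ single σ * rest))) (sym (^-zeroˡ (aexc σ))) ⟩
        x ^ excB σ * (1ℚ ^ aexc σ * (x ^ single σ * rest))
      ∎
      where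
        rest : ℚ
        rest = t ^ fixC σ * (p ^ csum σ * q ^ cyc σ)
        rearrange : ∀ a b c → (a * b) * c ≡ a * (1ℚ * (b * c))
        rearrange = solve-∀ ℚ-ring

Anr-at-y≡1 : ∀ n r (x t p q : ℚ) .{{_ : NonZero (qint (suc r) p)}} →
  Anr n (suc r) x 1ℚ x t p q ≡ qint (suc r) p ^ n * A n x ((t + x * (p * qint r p)) ÷ qint (suc r) p) q
Anr-at-y≡1 n r x t p q = begin
    Anr n (suc r) x 1ℚ x t p q
  ≡⟨ Anr≡A n r x 1ℚ x t p q ⟩
    R ^ n * (1ℚ ^ n * A n (x ÷ 1ℚ) (T ÷ 1ℚ) q)
  ≡⟨ cong (R ^ n *_) (trans (cong (_* A n (x ÷ 1ℚ) (T ÷ 1ℚ) q) (^-zeroˡ n)) (ℚ.*-identityˡ _)) ⟩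
    R ^ n * A n (x ÷ 1ℚ) (T ÷ 1ℚ) q
  -- z ÷ 1ℚ is z * 1/ 1ℚ, and 1/ 1ℚ computes to 1ℚ
  ≡⟨ cong (R ^ n *_) (cong₂ (λ u v → A n u v q) (ℚ.*-identityʳ x) (ℚ.*-identityʳ T)) ⟩
    R ^ n * A n x T q
  ∎
  where
    T R : ℚ
    R = qint (suc r) p
    T = (t + x * (p * qint r p)) ÷ R

theorem47 : (r n : ℕ) → 1 ≤ r → 1 ≤ n →
    ((x y s t p q : ℚ) → .{{_ : NonZero y}} → .{{_ : NonZero (qint r p)}} →
      Anr n r x y s t p q
        ≡ ((qint r p) ^ n) * ((y ^ n) * A n (x ÷ y) (((t + (s * (p * (qint (pred r) p)))) ÷ (qint r p)) ÷ y) q))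
    × ((x t p q : ℚ) → .{{_ : NonZero (qint r p)}} →
      (Bnr n r x t p q ≡ Anr n r x 1ℚ x t p q)
      × (Anr n r x 1ℚ x t p q
          ≡ ((qint r p) ^ n) * A n x ((t + (x * (p * (qint (pred r) p)))) ÷ (qint r p)) q))
theorem47 (suc r) n _ _ =
  (λ x y s t p q → Anr≡A n r x y s t p q) ,
  (λ x t p q → Bnr≡Anr n (suc r) x t p q , Anr-at-y≡1 n r x t p q)
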